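{- Let $\sigma$ be a PCF type, $t$ a PCF term of type $\sigma$, $I$ a type in $\mathcal U_0$, and $d:I\to[\![\sigma]\!]$ a directed family. If $t\,R_\sigma\, d_i$ for every $i:I$, then $t\,R_\sigma\,\bigsqcup_{i:I}d_i$.
   Context: Ambient theory: intensional Martin-Löf type theory with function extensionality, propositional extensionality and propositional truncation $\|-\|$. There are universes $\mathcal U_0:\mathcal U_1$, and $\Omega$ is the type of propositions in $\mathcal U_0$. PCF types are $\iota$ and $\sigma\Rightarrow\tau$. PCF terms are generated inductively by the following constants and application: - $\mathsf{zero}:\iota$; - $\mathsf{succ},\mathsf{pred}:\iota\Rightarrow\iota$; - $\mathsf{ifz}:\iota\Rightarrow\iota\Rightarrow\iota\Rightarrow\iota$; - $\mathsf k_{\sigma,\tau}:\sigma\Rightarrow\tau\Rightarrow\sigma$; - $\mathsf s_{\sigma,\tau,\rho}:(\sigma\Rightarrow\tau\Rightarrow\rho)\Rightarrow(\sigma\Rightarrow\tau)\Rightarrow\sigma\Rightarrow\rho$; - $\mathsf{fix}_\sigma:(\sigma\Rightarrow\sigma)\Rightarrow\sigma$; - application $st$. Numerals: $\underline0=\mathsf{zero}$ and $\underline{n+1}=\mathsf{succ}\,\underline n$. The relation $\tilde\leadsto$ is the inductive family generated by: - $\mathsf{pred}\,\underline0\tilde\leadsto\underline0$; - $\mathsf{pred}\,\underline{n+1}\tilde\leadsto\underline n$; - $\mathsf{ifz}\,s\,t\,\underline0\tilde\leadsto s$; - $\mathsf{ifz}\,s\,t\,\underline{n+1}\tilde\leadsto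 t$; - $\mathsf kst\tilde\leadsto s$; - $\mathsf sfgt\tilde\leadsto ft(gt)$; - $\mathsf{fix}\,f\tilde\leadsto f(\mathsf{fix}\,f)$; - congruence for application in the function position; - congruence under $\mathsf{succ}$ and $\mathsf{pred}$; - congruence in the last argument of $\mathsf{ifz}$. Set $s\leadsto t:=\|s\tilde\leadsto t\|$. The relation $\leadsto^*$ is $\|\cdot\|$ applied to the inductive reflexive-transitive closure (constructors: extend, refl, trans) of $\leadsto$. The lifting is $\mathcal L(X)=\sum_{P:\Omega}(P\to X)$ with $\mathrm{isdefined}$ the first projection and $\mathrm{value}(P,\varphi)(p)=\varphi(p)$. It is ordered by $l\sqsubseteq m:=(\mathrm{isdefined}(l)\to l=m)$. The least upper bound of a directed family $u:I\to\mathcal L(X)$ is $(\|\sum_i\mathrm{isdefined}(u_i)\|,\phi)$, where $\phi$ factorises $(i,d)\mapsto\mathrm{value}(u_i)(d)$ through the truncation. A family $u:I\to X$ is directed if $\|I\|$ holds and $\prod_{i,j}\|\sum_k u_i\le u_k\times u_j\le u_k\|$. $[\![\iota]\!]=\mathcal L(\mathbb N)$, and $[\![\sigma\Rightarrow\tau]\!]$ is the dcpo with $\bot$ of continuous (directed-sup preserving) maps $[\![\sigma]\!]\to[\![\tau]\!]$, with pointwise order and pointwise suprema. The logical relation $R_\sigma$ between PCF terms of type $\sigma$ and elements of $[\![\sigma]\!]$ is defined by induction on $\sigma$: - $t\,R_\iota\,d:=\prod_{p:\mathrm{isdefined}(d)}t\leadsto^*\underline{\mathrm{value}(d)(p)}$;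 - $s\,R_{\tau\Rightarrow\rho}\,f:=\prod_{t:\tau}\prod_{d:[\![\tau]\!]}(t\,R_\tau\,d\to st\,R_\rho\,f(d))$. -}

module Defs where

open import Level using (Level; Lift) renaming (zero to ℓ0; suc to lsuc)
open import Agda.Primitive using (Setω)
open import Data.Nat using (ℕ; zero; suc)
open import Data.Nat.Properties using (≡-irrelevant)
open import Data.Product using (Σ; _,_; proj₁; proj₂; _×_)
open import Function using (_∘_)
open import Relation.Binary.PropositionalEquality
  using (_≡_; refl; sym; trans; cong; subst)

-- Ambient theory: MLTT + funext + propext + propositional truncation.
-- These are not available in safe Agda, so they are packaged as a
-- record of assumptions which the theorem takes as a parameter.

isProp : ∀ {ℓ} → Set ℓ → Set ℓ
isProp A = (x y : A) → x ≡ y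

record Assumptions : Setω where
  field
    ∥_∥       : ∀ {ℓ} → Set ℓ → Set ℓ
    ∣_∣       : ∀ {ℓ} {A : Set ℓ} → A → ∥ A ∥
    ∥∥-isProp : ∀ {ℓ} {A : Set ℓ} → isProp ∥ A ∥
    ∥∥-rec    : ∀ {ℓ ℓ'} {A : Set ℓ} {P : Set ℓ'} → isProp P → (A → P) → ∥ A ∥ → P
    funext    : ∀ {ℓ ℓ'} {A : Set ℓ} {B : A → Set ℓ'} {f g : (x : A) → B x}
              → ((x : A) → f x ≡ g x) → f ≡ g
    propext   : ∀ {ℓ} {P Q : Set ℓ} → isProp P → isProp Q → (P → Q) → (Q → P) → P ≡ Q

infixr 30 _⇒_
data Ty : Set where
  ι   : Ty
  _⇒_ : Ty → Ty → Ty

infixl 40 _·_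
data PCF : Ty → Set where
  zero' : PCF ι
  succ' : PCF (ι ⇒ ι)
  pred' : PCF (ι ⇒ ι)
  ifz   : PCF (ι ⇒ ι ⇒ ι ⇒ ι)
  K     : ∀ {σ τ} → PCF (σ ⇒ τ ⇒ σ)
  S     : ∀ {σ τ ρ} → PCF ((σ ⇒ τ ⇒ ρ) ⇒ (σ ⇒ τ) ⇒ σ ⇒ ρ)
  Fix   : ∀ {σ} → PCF ((σ ⇒ σ) ⇒ σ)
  _·_   : ∀ {σ τ} → PCF (σ ⇒ τ) → PCF σ → PCF τ

numeral : ℕ → PCF ι
numeral zero    = zero'
numeral (suc n) = succ' · numeral n

infix 4 _~↝_
data _~↝_ : {σ : Ty} → PCF σ → PCF σ → Set where
  pred-zero : pred' · numeral 0 ~↝ numeral 0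
  pred-suc  : (n : ℕ) → pred' · numeral (suc n) ~↝ numeral n
  ifz-zero  : (s t : PCF ι) → ifz · s · t · numeral 0 ~↝ s
  ifz-suc   : (s t : PCF ι) (n : ℕ) → ifz · s · t · numeral (suc n) ~↝ t
  k-step    : ∀ {σ τ} (s : PCF σ) (t : PCF τ) → K · s · t ~↝ s
  s-step    : ∀ {σ τ ρ} (f : PCF (σ ⇒ τ ⇒ ρ)) (g : PCF (σ ⇒ τ)) (t : PCF σ)
            → S · f · g · t ~↝ f · t · (g · t)
  fix-step  : ∀ {σ} (f : PCF (σ ⇒ σ)) → Fix · f ~↝ f · (Fix · f)
  ·-step    : ∀ {σ τ} {s s' : PCF (σ ⇒ τ)} (t : PCF σ) → s ~↝ s' → s · t ~↝ s' · t
  succ-step : {s t : PCF ι} → s ~↝ t → succ' · s ~↝ succ' · t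
  pred-step : {s t : PCF ι} → s ~↝ t → pred' · s ~↝ pred' · t
  ifz-step  : (s t : PCF ι) {r r' : PCF ι} → r ~↝ r' → ifz · s · t · r ~↝ ifz · s · t · r'

module Semantics (A : Assumptions) where
  open Assumptions A

  infix 4 _↝_ _↝*_
  _↝_ : {σ : Ty} → PCF σ → PCF σ → Set
  s ↝ t = ∥ s ~↝ t ∥

  data RTC {σ : Ty} : PCF σ → PCF σ → Set where
    extend : {s t : PCF σ} → s ↝ t → RTC s t
    refl*  : {s : PCF σ} → RTC s s
    trans* : {s t u : PCF σ} → RTC s t → RTC t u → RTC s u

  _↝*_ : {σ : Ty} → PCF σ → PCF σ → Set
  s ↝* t = ∥ RTC s t ∥

  ∥∥-map : ∀ {ℓ ℓ'} {X : Set ℓ} {Y : Set ℓ'} → (X → Y) → ∥ X ∥ → ∥ Y ∥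
  ∥∥-map f = ∥∥-rec ∥∥-isProp (∣_∣ ∘ f)

  Ω : Set₁
  Ω = Σ Set isProp

  𝓛 : Set → Set₁
  𝓛 X = Σ Ω (λ P → proj₁ P → X)

  isdefined : {X : Set} → 𝓛 X → Set
  isdefined l = proj₁ (proj₁ l)

  isdefined-isProp : {X : Set} (l : 𝓛 X) → isProp (isdefined l)
  isdefined-isProp l = proj₂ (proj₁ l)

  value : {X : Set} (l : 𝓛 X) → isdefined l → X
  value l = proj₂ l

  isDirected : {I : Set} {D : Set₁} (_≤_ : D → D → Set₁) (u : I → D) → Set₁
  isDirected {I} _≤_ u =
    ∥ I ∥ × ((i j : I) → ∥ Σ I (λ k → (u i ≤ u k) × (u j ≤ u k)) ∥)

  -- dcpos (only the structure relevant here)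
  record DCPO : Set₂ where
    field
      Carrier : Set₁
      _⊑_     : Carrier → Carrier → Set₁
      ⊑-trans : {x y z : Carrier} → x ⊑ y → y ⊑ z → x ⊑ z
      ∐       : {I : Set} (α : I → Carrier) → isDirected _⊑_ α → Carrier
      ∐-ub    : {I : Set} (α : I → Carrier) (δ : isDirected _⊑_ α) (i : I) → α i ⊑ ∐ α δ
      ∐-lub   : {I : Set} (α : I → Carrier) (δ : isDirected _⊑_ α) (y : Carrier)
              → ((i : I) → α i ⊑ y) → ∐ α δ ⊑ y

  ⟨_⟩ : DCPO → Set₁
  ⟨ D ⟩ = DCPO.Carrier D

  isSup : (D : DCPO) {I : Set} → ⟨ D ⟩ → (I → ⟨ D ⟩) → Set₁
  isSup D {I} x α = ((i : I) → α i ⊑ x) × ((y : ⟨ D ⟩) → ((i : I) → α i ⊑ y) → x ⊑ y)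
    where open DCPO D

  isContinuous : (D E : DCPO) → (⟨ D ⟩ → ⟨ E ⟩) → Set₁
  isContinuous D E f = {I : Set} (α : I → ⟨ D ⟩) (δ : isDirected (DCPO._⊑_ D) α)
                     → isSup E (f (DCPO.∐ D α δ)) (f ∘ α)

  private
    Σ-prop-≡ : ∀ {a b} {X : Set a} {P : X → Set b} → ((x : X) → isProp (P x))
             → {u v : Σ X P} → proj₁ u ≡ proj₁ v → u ≡ v
    Σ-prop-≡ h {x , p} {.x , q} refl = cong (x ,_) (h x p q)

    uip : ∀ {a} {X : Set a} {x y : X} → isProp (x ≡ y)
    uip refl refl = refl

    isProp-isProp : ∀ {a} {P : Set a} → isProp (isProp P)
    isProp-isProp h h' = funext λ x → funext λ y → uip (h x y) (h' x y)

    module Factor {B : Set} (f : B → ℕ) (c : (a b : B) → f a ≡ f b) where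
      Img : Set
      Img = Σ ℕ (λ x → ∥ Σ B (λ b → f b ≡ x) ∥)

      Img-isProp : isProp Img
      Img-isProp (x , p) (y , q) = Σ-prop-≡ (λ _ → ∥∥-isProp)
        (∥∥-rec ≡-irrelevant (λ { (a , e) → ∥∥-rec ≡-irrelevant
          (λ { (b , e') → trans (sym e) (trans (c a b) e') }) q }) p)

      img : ∥ B ∥ → Img
      img = ∥∥-rec Img-isProp (λ b → f b , ∣ b , refl ∣)

      factor : ∥ B ∥ → ℕ
      factor t = proj₁ (img t)

      factor-const : (b : B) (t : ∥ B ∥) → f b ≡ factor t
      factor-const b t = ∥∥-rec ≡-irrelevant
        (λ { (b' , e) → trans (c b b') e }) (proj₂ (img t))

    value-≡ : {l m : 𝓛 ℕ} → l ≡ m → (p : isdefined l) (q : isdefined m) → value l p ≡ value m q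
    value-≡ {l} refl p q = cong (value l) (isdefined-isProp l p q)

    lift-ext' : {P Q : Ω} → P ≡ Q → (φ : proj₁ P → ℕ) (ψ : proj₁ Q → ℕ)
              → ((p : proj₁ P) (q : proj₁ Q) → φ p ≡ ψ q) → _≡_ {A = 𝓛 ℕ} (P , φ) (Q , ψ)
    lift-ext' refl φ ψ v = cong (_ ,_) (funext λ p → v p p)

    lift-ext : {l m : 𝓛 ℕ} → (isdefined l → isdefined m) → (isdefined m → isdefined l)
             → ((p : isdefined l) (q : isdefined m) → value l p ≡ value m q) → l ≡ m
    lift-ext {(P , hP) , φ} {(Q , hQ) , ψ} f g v =
      lift-ext' (Σ-prop-≡ (λ _ → isProp-isProp) (propext hP hQ f g)) φ ψ v

  _⊑𝓛_ : 𝓛 ℕ → 𝓛 ℕ → Set₁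
  l ⊑𝓛 m = isdefined l → l ≡ m

  private
    dir-const : {I : Set} (u : I → 𝓛 ℕ) → isDirected _⊑𝓛_ u
              → (a b : Σ I (λ i → isdefined (u i)))
              → value (u (proj₁ a)) (proj₂ a) ≡ value (u (proj₁ b)) (proj₂ b)
    dir-const u (_ , dir) (i , p) (j , q) = ∥∥-rec ≡-irrelevant
      (λ { (k , a , b) → value-≡ (trans (a p) (sym (b q))) p q }) (dir i j)

  ∐𝓛 : {I : Set} (u : I → 𝓛 ℕ) → isDirected _⊑𝓛_ u → 𝓛 ℕ
  ∐𝓛 {I} u δ = (∥ Σ I (λ i → isdefined (u i)) ∥ , ∥∥-isProp)
              , Factor.factor (λ a → value (u (proj₁ a)) (proj₂ a)) (dir-const u δ)

  𝓛ℕ : DCPO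
  𝓛ℕ = record
    { Carrier = 𝓛 ℕ
    ; _⊑_     = _⊑𝓛_
    ; ⊑-trans = λ f g p → trans (f p) (g (subst isdefined (f p) p))
    ; ∐       = ∐𝓛
    ; ∐-ub    = λ u δ i p → lift-ext (λ p' → ∣ i , p' ∣) (λ _ → p)
                  (λ p' t → Factor.factor-const _ (dir-const u δ) (i , p') t)
    ; ∐-lub   = λ u δ y h t → lift-ext
                  (λ _ → ∥∥-rec (isdefined-isProp y)
                           (λ { (i , p) → subst isdefined (h i p) p }) t)
                  (λ _ → t)
                  (λ t' q → ∥∥-rec ≡-irrelevant
                     (λ { (i , p) → trans (sym (Factor.factor-const _ (dir-const u δ) (i , p) t'))
                                          (value-≡ (h i p) p q) }) t)
    }

  _⟹_ : DCPO → DCPO → DCPO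
  D ⟹ E = record
    { Carrier = Σ (⟨ D ⟩ → ⟨ E ⟩) (isContinuous D E)
    ; _⊑_     = _≤_
    ; ⊑-trans = λ a b x → E.⊑-trans (a x) (b x)
    ; ∐       = sup
    ; ∐-ub    = λ α δ i x → E.∐-ub _ (pw α δ x) i
    ; ∐-lub   = λ α δ y h x → E.∐-lub _ (pw α δ x) (proj₁ y x) (λ i → h i x)
    }
    where
      module D = DCPO D
      module E = DCPO E
      C = Σ (⟨ D ⟩ → ⟨ E ⟩) (isContinuous D E)

      _≤_ : C → C → Set₁
      f ≤ g = (x : ⟨ D ⟩) → proj₁ f x E.⊑ proj₁ g x

      pw : {I : Set} (α : I → C) → isDirected _≤_ α → (x : ⟨ D ⟩)
         → isDirected E._⊑_ (λ i → proj₁ (α i) x)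
      pw α (inh , dir) x = inh , λ i j → ∥∥-map (λ { (k , a , b) → k , a x , b x }) (dir i j)

      sup : {I : Set} (α : I → C) → isDirected _≤_ α → C
      sup α δ = (λ x → E.∐ (λ i → proj₁ (α i) x) (pw α δ x))
              , λ β ε →
                  (λ j → E.∐-lub _ (pw α δ (β j)) _
                           (λ i → E.⊑-trans (proj₁ (proj₂ (α i) β ε) j)
                                            (E.∐-ub _ (pw α δ (D.∐ β ε)) i)))
                , (λ y h → E.∐-lub _ (pw α δ (D.∐ β ε)) y
                           (λ i → proj₂ (proj₂ (α i) β ε) y
                                    (λ j → E.⊑-trans (E.∐-ub _ (pw α δ (β j)) i) (h j))))

  ⟦_⟧ : Ty → DCPO
  ⟦ ι ⟧     = 𝓛ℕ
  ⟦ σ ⇒ τ ⟧ = ⟦ σ ⟧ ⟹ ⟦ τ ⟧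

  ∐⟦_⟧ : (σ : Ty) {I : Set} (d : I → ⟨ ⟦ σ ⟧ ⟩) → isDirected (DCPO._⊑_ ⟦ σ ⟧) d → ⟨ ⟦ σ ⟧ ⟩
  ∐⟦ σ ⟧ = DCPO.∐ ⟦ σ ⟧

  R : (σ : Ty) → PCF σ → ⟨ ⟦ σ ⟧ ⟩ → Set₁
  R ι t d       = Lift (lsuc ℓ0) ((p : isdefined d) → t ↝* numeral (value d p))
  R (σ ⇒ τ) s f = (t : PCF σ) (d : ⟨ ⟦ σ ⟧ ⟩) → R σ t d → R τ (s · t) (proj₁ f d)

-- At base type, the supremum is defined exactly when some dᵢ is, and then
-- dᵢ ⊑ ⨆ d makes the two values agree, so the reduction witnessing tRdᵢ
-- also witnesses tR(⨆ d). At function types suprema are pointwise, so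
-- (⨆ d) e is the supremum of the family dᵢ e, to which induction applies.
module Submission where

open import Defs
open import Level using (lift; lower)
open import Data.Nat using (ℕ)
open import Data.Product using (Σ; _,_; proj₁)
open import Relation.Binary.PropositionalEquality using (_≡_; refl; cong; subst)

module _ (A : Assumptions) where
  open Assumptions A
  open Semantics A

  value-≡ : {X : Set} {l m : 𝓛 X} → l ≡ m
          → (p : isdefined l) (q : isdefined m) → value l p ≡ value m q
  value-≡ {l = l} refl p q = cong (value l) (isdefined-isProp l p q)

  R-ι-∐ : (t : PCF ι) {I : Set} (d : I → 𝓛 ℕ) (δ : isDirected _⊑𝓛_ d)
        → ((i : I) → R ι t (d i)) → R ι t (∐𝓛 d δ)
  R-ι-∐ t {I} d δ h = lift λ q → ∥∥-rec ∥∥-isProp (reduces q) q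
    where
    reduces : (q : isdefined (∐𝓛 d δ)) → Σ I (λ i → isdefined (d i))
            → t ↝* numeral (value (∐𝓛 d δ) q)
    reduces q (i , p) =
      subst (λ n → t ↝* numeral n) (value-≡ (DCPO.∐-ub 𝓛ℕ d δ i p) p q) (lower (h i) p)

lemma7p7 : (A : Assumptions) → let open Semantics A in
    (σ : Ty) (t : PCF σ) (I : Set) (d : I → ⟨ ⟦ σ ⟧ ⟩)
    (δ : isDirected (DCPO._⊑_ ⟦ σ ⟧) d)
    → ((i : I) → R σ t (d i))
    → R σ t (∐⟦ σ ⟧ d δ)
lemma7p7 A ι t I d δ h = R-ι-∐ A t d δ h
lemma7p7 A (σ ⇒ τ) t I d δ h s e r =
  lemma7p7 A τ (t · s) I (λ i → proj₁ (d i) e) _ (λ i → h i s e r)
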